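{- Let $V$ be an $m$-dimensional subspace of $\Sigma=\mathrm{PG}(n,q)$ and let $K$ be a set of points of $\Sigma$ such that every hyperplane of $\Sigma$ not containing $V$ meets $K$ in the same number of points. Then $K\cup V$ is a cone with vertex $V$.
   Context: A cone with vertex a subspace $V$ is a point set $C\supseteq V$ such that for every $X\in C$ and $Q\in V$ all points of the line $XQ$ lie in $C$. -}

module Defs where

open import Level using (0ℓ)
open import Data.Nat using (ℕ; zero; suc)
open import Data.Empty using (⊥)
open import Data.Product using (Σ; ∃; _×_; _,_)
open import Data.Sum using (_⊎_)
open import Data.Vec using (Vec; []; _∷_; zipWith; replicate; foldr)
open import Data.List using (List; []; _∷_; map; concatMap; filter; length)
open import Data.List.Membership.Propositional using (_∈_)
open import Relation.Nullary using (¬_; Dec; yes; no)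
open import Relation.Nullary.Decidable using (_×-dec_; _⊎-dec_)
open import Relation.Unary using (Pred; Decidable)
open import Relation.Binary.PropositionalEquality using (_≡_)
open import Algebra.Structures using (IsCommutativeRing)

record FiniteField : Set₁ where
  infixl 6 _+_
  infixl 7 _*_
  field
    Carrier  : Set
    _+_ _*_  : Carrier → Carrier → Carrier
    -_       : Carrier → Carrier
    0# 1#    : Carrier
    isCommutativeRing : IsCommutativeRing _≡_ _+_ _*_ -_ 0# 1#
    0≢1      : ¬ (0# ≡ 1#)
    inverse  : ∀ x → ¬ (x ≡ 0#) → ∃ λ y → x * y ≡ 1#
    _≟_      : (x y : Carrier) → Dec (x ≡ y)
    elements : List Carrier
    complete : ∀ x → x ∈ elements

module _ (F : FiniteField) where
  open FiniteField F

  -- vectors of F^(n+1): homogeneous coordinates of PG(n,q)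
  Vector : ℕ → Set
  Vector n = Vec Carrier (suc n)

  zeroV : ∀ {k} → Vec Carrier k
  zeroV = replicate _ 0#

  _+ᵥ_ : ∀ {k} → Vec Carrier k → Vec Carrier k → Vec Carrier k
  _+ᵥ_ = zipWith _+_

  _·ᵥ_ : ∀ {k} → Carrier → Vec Carrier k → Vec Carrier k
  a ·ᵥ v = Data.Vec.map (a *_) v

  dot : ∀ {k} → Vec Carrier k → Vec Carrier k → Carrier
  dot u v = foldr _ _+_ 0# (zipWith _*_ u v)

  lincomb : ∀ {k j} → Vec Carrier j → Vec (Vec Carrier k) j → Vec Carrier k
  lincomb []       []       = zeroV
  lincomb (c ∷ cs) (b ∷ bs) = (c ·ᵥ b) +ᵥ lincomb cs bs

  LinIndep : ∀ {k j} → Vec (Vec Carrier k) j → Set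
  LinIndep bs = ∀ cs → lincomb cs bs ≡ zeroV → cs ≡ zeroV

  InSpan : ∀ {k j} → Vec (Vec Carrier k) j → Vec Carrier k → Set
  InSpan bs v = ∃ λ cs → v ≡ lincomb cs bs

  -- Points of PG(n,q) are represented by their unique normalized
  -- homogeneous coordinate vector: first nonzero coordinate equal to 1.
  Normalized : ∀ {k} → Vec Carrier k → Set
  Normalized []       = ⊥
  Normalized (x ∷ xs) = (x ≡ 1#) ⊎ ((x ≡ 0#) × Normalized xs)

  normalized? : ∀ {k} → (v : Vec Carrier k) → Dec (Normalized v)
  normalized? []       = no (λ ())
  normalized? (x ∷ xs) = (x ≟ 1#) ⊎-dec ((x ≟ 0#) ×-dec normalized? xs)

  IsPoint : (n : ℕ) → Vector n → Set
  IsPoint n = Normalized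

  allVecs : (k : ℕ) → List (Vec Carrier k)
  allVecs zero    = [] ∷ []
  allVecs (suc k) = concatMap (λ x → map (x ∷_) (allVecs k)) elements

  allPoints : (n : ℕ) → List (Vector n)
  allPoints n = filter normalized? (allVecs (suc n))

  -- An m-dimensional subspace of PG(n,q), given by m+1 independent vectors.
  record Subspace (n m : ℕ) : Set where
    field
      basis  : Vec (Vector n) (suc m)
      indep  : LinIndep basis

  InSub : ∀ {n m} → Subspace n m → Pred (Vector n) 0ℓ
  InSub V P = IsPoint _ P × InSpan (Subspace.basis V) P

  Hyperplane : ℕ → Set
  Hyperplane n = Σ (Vector n) λ a → ¬ (a ≡ zeroV)

  InHyp : ∀ {n} → Hyperplane n → Pred (Vector n) 0ℓ
  InHyp (a , _) P = IsPoint _ P × (dot a P ≡ 0#)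

  inHyp? : ∀ {n} (H : Hyperplane n) → Decidable (InHyp H)
  inHyp? (a , _) P = normalized? P ×-dec (dot a P ≟ 0#)

  ContainsSub : ∀ {n m} → Hyperplane n → Subspace n m → Set
  ContainsSub H V = ∀ P → InSub V P → InHyp H P

  countOn : ∀ {n} {K : Pred (Vector n) 0ℓ} → Decidable K → Hyperplane n → ℕ
  countOn K? H = length (filter (λ P → K? P ×-dec inHyp? H P) (allPoints _))

  OnLine : ∀ {n} → Vector n → Vector n → Pred (Vector n) 0ℓ
  OnLine X Q P = IsPoint _ P × InSpan (X ∷ Q ∷ []) P

  IsCone : ∀ {n m} → Subspace n m → Pred (Vector n) 0ℓ → Set
  IsCone V C =
    (∀ P → InSub V P → C P) ×
    (∀ X Q P → IsPoint _ X → C X → InSub V Q → ¬ (X ≡ Q) → OnLine X Q P → C P)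

{-# OPTIONS --safe #-}
module Submission where

-- For a point Y let I(Y) be the number of pairs (a, P) with a ∈ F^(n+1) any coordinate vector
-- (zero included), P ∈ K and a·Y = a·P = 0. Summing over P: q^n vectors annihilate one point and
-- q^(n-1) annihilate two distinct points, so q·I(Y) = |K|·q^n + [Y ∈ K]·(q-1)·q^n.
-- Summing over a instead: a vector annihilating V annihilates X exactly when it annihilates
-- P = αX + βQ (Q ∈ V, α ≠ 0); every other a meets K in the same number of points by hypothesis;
-- and each point is annihilated by q^n vectors in all. Hence I(X) = I(P), and X ∈ K forces P ∈ K.

open import Defs
open import Level using (0ℓ)
open import Data.Nat using (ℕ; zero; suc)
import Data.Nat as ℕ
import Data.Nat.Properties as ℕ
open import Data.Empty using (⊥-elim)
open import Data.Product using (∃; _×_; _,_; proj₁; proj₂)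
open import Data.Sum using (_⊎_; inj₁; inj₂)
open import Data.Vec using (Vec; []; _∷_)
import Data.Vec as Vec
open import Data.Vec.Properties using (≡-dec; zipWith-identityʳ; zipWith-identityˡ; map-replicate; ∷-injective)
open import Data.Vec.Relation.Unary.All as VecAll using ([]; _∷_)
open import Data.List using (List; []; _∷_; _++_; map; concatMap; filter; length; deduplicate)
open import Data.List.Membership.Propositional using (_∈_; lose)
open import Data.List.Membership.Propositional.Properties
  using (∈-concatMap⁺; ∈-map⁺; ∈-deduplicate⁺; ∈-filter⁺; ∈-filter⁻)
open import Data.List.Relation.Unary.Any using (here; there; any?; satisfied)
open import Data.List.Relation.Unary.All as All using (All; []; _∷_; all?)
open import Data.List.Relation.Unary.All.Properties using (¬All⇒Any¬)
open import Data.List.Relation.Unary.AllPairs using ([]; _∷_)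
open import Data.List.Relation.Unary.Unique.Propositional using (Unique)
open import Data.List.Relation.Unary.Unique.DecPropositional.Properties using (deduplicate-!)
open import Function using (_∘_; _⇔_; mk⇔; Equivalence)
open import Relation.Nullary using (¬_; Dec; yes; no; ¬?)
open import Relation.Nullary.Decidable using (_×-dec_)
open import Relation.Unary using (Pred; Decidable)
open import Relation.Binary.Definitions using (DecidableEquality)
open import Relation.Binary.PropositionalEquality
open import Algebra.Bundles using (CommutativeRing)
open import Algebra.Structures using (IsCommutativeRing)

module Counting where
  open import Data.Nat using (_+_; _*_; _≤_; z≤n)
  open import Data.Nat.Properties
    using ( +-assoc; +-comm; +-cancelʳ-≡; *-zeroʳ; *-distribˡ-+; *-distribʳ-+
          ; m≤m+n; m≤n+m; ≤-trans; +-mono-≤; +-commutativeSemigroup)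
  open import Algebra.Properties.CommutativeSemigroup +-commutativeSemigroup using (interchange)
  open ≡-Reasoning

  ∑ : ∀ {A : Set} → List A → (A → ℕ) → ℕ
  ∑ []       f = 0
  ∑ (x ∷ xs) f = f x + ∑ xs f

  syntax ∑ xs (λ x → e) = ∑[ x ∈ xs ] e

  module _ {A : Set} where

    ∑-cong : ∀ (xs : List A) {f g : A → ℕ} → (∀ {x} → x ∈ xs → f x ≡ g x) → ∑ xs f ≡ ∑ xs g
    ∑-cong []       f≗g = refl
    ∑-cong (x ∷ xs) f≗g = cong₂ _+_ (f≗g (here refl)) (∑-cong xs (f≗g ∘ there))

    ∑-+ : ∀ (xs : List A) (f g : A → ℕ) → ∑[ x ∈ xs ] (f x + g x) ≡ ∑ xs f + ∑ xs g
    ∑-+ []       f g = refl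
    ∑-+ (x ∷ xs) f g = trans (cong (f x + g x +_) (∑-+ xs f g)) (interchange (f x) (g x) (∑ xs f) (∑ xs g))

    ∑-*ˡ : ∀ (xs : List A) c (f : A → ℕ) → ∑[ x ∈ xs ] (c * f x) ≡ c * ∑ xs f
    ∑-*ˡ []       c f = sym (*-zeroʳ c)
    ∑-*ˡ (x ∷ xs) c f = trans (cong (c * f x +_) (∑-*ˡ xs c f)) (sym (*-distribˡ-+ c (f x) (∑ xs f)))

    ∑-*ʳ : ∀ (xs : List A) c (f : A → ℕ) → ∑[ x ∈ xs ] (f x * c) ≡ ∑ xs f * c
    ∑-*ʳ []       c f = refl
    ∑-*ʳ (x ∷ xs) c f = trans (cong (f x * c +_) (∑-*ʳ xs c f)) (sym (*-distribʳ-+ c (f x) (∑ xs f)))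

    ∑-const : ∀ (xs : List A) c → ∑[ _ ∈ xs ] c ≡ length xs * c
    ∑-const []       c = refl
    ∑-const (x ∷ xs) c = cong (c +_) (∑-const xs c)

    ∑-++ : ∀ (xs ys : List A) (f : A → ℕ) → ∑ (xs ++ ys) f ≡ ∑ xs f + ∑ ys f
    ∑-++ []       ys f = refl
    ∑-++ (x ∷ xs) ys f = trans (cong (f x +_) (∑-++ xs ys f)) (sym (+-assoc (f x) (∑ xs f) (∑ ys f)))

    ∑-mono-≤ : ∀ (xs : List A) {f g : A → ℕ} → (∀ x → f x ≤ g x) → ∑ xs f ≤ ∑ xs g
    ∑-mono-≤ []       f≤g = z≤n
    ∑-mono-≤ (x ∷ xs) f≤g = +-mono-≤ (f≤g x) (∑-mono-≤ xs f≤g)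

    term≤∑ : ∀ {xs : List A} (f : A → ℕ) {x} → x ∈ xs → f x ≤ ∑ xs f
    term≤∑ {y ∷ xs} f (here refl)  = m≤m+n (f y) (∑ xs f)
    term≤∑ {y ∷ xs} f (there x∈xs) = ≤-trans (term≤∑ f x∈xs) (m≤n+m (∑ xs f) (f y))

    -- Pointwise f x·w x + g x·c = g x·w x + f x·c; sum it and cancel c·∑ f = c·∑ g.
    ∑-weighted-cong : ∀ (xs : List A) {f g w : A → ℕ} c → (∀ x → f x ≡ g x ⊎ w x ≡ c) →
      ∑ xs f ≡ ∑ xs g → ∑[ x ∈ xs ] (f x * w x) ≡ ∑[ x ∈ xs ] (g x * w x)
    ∑-weighted-cong xs {f} {g} {w} c agree ∑f≡∑g = +-cancelʳ-≡ _ _ _ (begin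
      ∑[ x ∈ xs ] (f x * w x) + ∑ xs g * c              ≡⟨ cong (_ +_) (∑-*ʳ xs c g) ⟨
      ∑[ x ∈ xs ] (f x * w x) + ∑[ x ∈ xs ] (g x * c)   ≡⟨ ∑-+ xs _ _ ⟨
      ∑[ x ∈ xs ] (f x * w x + g x * c)                 ≡⟨ ∑-cong xs (λ {x} _ → swap x) ⟩
      ∑[ x ∈ xs ] (g x * w x + f x * c)                 ≡⟨ ∑-+ xs _ _ ⟩
      ∑[ x ∈ xs ] (g x * w x) + ∑[ x ∈ xs ] (f x * c)   ≡⟨ cong (_ +_) (∑-*ʳ xs c f) ⟩
      ∑[ x ∈ xs ] (g x * w x) + ∑ xs f * c              ≡⟨ cong (λ t → _ + t * c) ∑f≡∑g ⟩
      ∑[ x ∈ xs ] (g x * w x) + ∑ xs g * c              ∎)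
      where
      swap : ∀ x → f x * w x + g x * c ≡ g x * w x + f x * c
      swap x with agree x
      ... | inj₁ f≡g = cong₂ (λ a b → a * w x + b * c) f≡g (sym f≡g)
      ... | inj₂ w≡c rewrite w≡c = +-comm (f x * c) (g x * c)

  ∑-swap : ∀ {A B : Set} (xs : List A) (ys : List B) (f : A → B → ℕ) →
    ∑[ x ∈ xs ] ∑[ y ∈ ys ] f x y ≡ ∑[ y ∈ ys ] ∑[ x ∈ xs ] f x y
  ∑-swap []       ys f = sym (trans (∑-const ys 0) (*-zeroʳ (length ys)))
  ∑-swap (x ∷ xs) ys f = trans (cong (∑ ys (f x) +_) (∑-swap xs ys f)) (sym (∑-+ ys (f x) _))

  ∑-map : ∀ {A B : Set} (h : A → B) (xs : List A) (f : B → ℕ) → ∑ (map h xs) f ≡ ∑[ x ∈ xs ] f (h x)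
  ∑-map h []       f = refl
  ∑-map h (x ∷ xs) f = cong (f (h x) +_) (∑-map h xs f)

  ∑-concatMap : ∀ {A B : Set} (h : A → List B) (xs : List A) (f : B → ℕ) →
    ∑ (concatMap h xs) f ≡ ∑[ x ∈ xs ] ∑ (h x) f
  ∑-concatMap h []       f = refl
  ∑-concatMap h (x ∷ xs) f = trans (∑-++ (h x) _ f) (cong (∑ (h x) f +_) (∑-concatMap h xs f))

  𝟙 : ∀ {P : Set} → Dec P → ℕ
  𝟙 (yes _) = 1
  𝟙 (no _)  = 0

  𝟙-yes : ∀ {P : Set} → P → (p : Dec P) → 𝟙 p ≡ 1
  𝟙-yes _  (yes _) = refl
  𝟙-yes pf (no ¬p) = ⊥-elim (¬p pf)

  𝟙-no : ∀ {P : Set} → ¬ P → (p : Dec P) → 𝟙 p ≡ 0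
  𝟙-no ¬p (yes pf) = ⊥-elim (¬p pf)
  𝟙-no _  (no _)   = refl

  𝟙-idem : ∀ {P : Set} (p : Dec P) → 𝟙 p * 𝟙 p ≡ 𝟙 p
  𝟙-idem (yes _) = refl
  𝟙-idem (no _)  = refl

  𝟙-cong : ∀ {P Q : Set} → P ⇔ Q → (p : Dec P) (q : Dec Q) → 𝟙 p ≡ 𝟙 q
  𝟙-cong P⇔Q (yes p) q = sym (𝟙-yes (Equivalence.to P⇔Q p) q)
  𝟙-cong P⇔Q (no ¬p) q = sym (𝟙-no (¬p ∘ Equivalence.from P⇔Q) q)

  𝟙-× : ∀ {P Q : Set} (p : Dec P) (q : Dec Q) → 𝟙 (p ×-dec q) ≡ 𝟙 p * 𝟙 q
  𝟙-× (yes _) (yes _) = refl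
  𝟙-× (yes _) (no _)  = refl
  𝟙-× (no _)  _       = refl

  length-filter≡∑𝟙 : ∀ {A : Set} {P : Pred A 0ℓ} (P? : Decidable P) (xs : List A) →
    length (filter P? xs) ≡ ∑[ x ∈ xs ] 𝟙 (P? x)
  length-filter≡∑𝟙 P? []       = refl
  length-filter≡∑𝟙 P? (x ∷ xs) with P? x
  ... | yes _ = cong suc (length-filter≡∑𝟙 P? xs)
  ... | no  _ = length-filter≡∑𝟙 P? xs

  module _ {A : Set} (_≟_ : DecidableEquality A) where

    ∑-𝟙≟-absent : ∀ {x} {xs : List A} → All (x ≢_) xs → ∑[ y ∈ xs ] 𝟙 (y ≟ x) ≡ 0
    ∑-𝟙≟-absent []                          = refl
    ∑-𝟙≟-absent {x} {y ∷ _} (x≢y ∷ x∉xs) with y ≟ x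
    ... | yes y≡x = ⊥-elim (x≢y (sym y≡x))
    ... | no  _   = ∑-𝟙≟-absent x∉xs

    ∑-𝟙≟-unique : ∀ {x} {xs : List A} → Unique xs → x ∈ xs → ∑[ y ∈ xs ] 𝟙 (y ≟ x) ≡ 1
    ∑-𝟙≟-unique {x} {y ∷ xs} (y∉xs ∷ !xs) x∈ with y ≟ x | x∈
    ... | yes refl | _            = cong suc (∑-𝟙≟-absent y∉xs)
    ... | no  y≢x  | here x≡y     = ⊥-elim (y≢x (sym x≡y))
    ... | no  _    | there x∈xs   = ∑-𝟙≟-unique !xs x∈xs

open Counting

∈-allVecs : ∀ (F : FiniteField) k (v : Vec (FiniteField.Carrier F) k) → v ∈ allVecs F k
∈-allVecs F zero    []      = here refl
∈-allVecs F (suc k) (x ∷ v) =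
  ∈-concatMap⁺ _ (lose (FiniteField.complete F x) (∈-map⁺ (x ∷_) (∈-allVecs F k v)))

∑-allVecs : ∀ (F : FiniteField) k (g : Vec (FiniteField.Carrier F) (suc k) → ℕ) →
  ∑ (allVecs F (suc k)) g ≡ ∑[ x ∈ FiniteField.elements F ] ∑[ w ∈ allVecs F k ] g (x ∷ w)
∑-allVecs F k g = trans (∑-concatMap _ (FiniteField.elements F) g)
  (∑-cong (FiniteField.elements F) (λ {x} _ → ∑-map (x ∷_) (allVecs F k) g))

module FieldFacts (F : FiniteField) where
  open FiniteField F
  open IsCommutativeRing isCommutativeRing
    using (+-identityˡ; +-identityʳ; -‿inverseˡ; zeroˡ; zeroʳ; *-identityʳ; *-comm; *-assoc)

  commutativeRing : CommutativeRing 0ℓ 0ℓ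
  commutativeRing = record { isCommutativeRing = isCommutativeRing }

  open CommutativeRing commutativeRing using (+-group)
  open import Algebra.Properties.Group +-group using (∙-cancelʳ)

  -- The field's _≟_ has no fixity declaration, so x + y ≟ 0# would parse as x + (y ≟ 0#).
  infix 4 _≟0

  _≟0 : ∀ x → Dec (x ≡ 0#)
  x ≟0 = x ≟ 0#

  *-cancelʳ-≢0 : ∀ {x y z} → ¬ z ≡ 0# → x * z ≡ y * z → x ≡ y
  *-cancelʳ-≢0 {x} {y} {z} z≢0 eq with inverse z z≢0
  ... | z⁻¹ , zz⁻¹≡1 = begin
    x               ≡⟨ *-identityʳ x ⟨
    x * 1#          ≡⟨ cong (x *_) zz⁻¹≡1 ⟨
    x * (z * z⁻¹)   ≡⟨ *-assoc x z z⁻¹ ⟨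
    x * z * z⁻¹     ≡⟨ cong (_* z⁻¹) eq ⟩
    y * z * z⁻¹     ≡⟨ *-assoc y z z⁻¹ ⟩
    y * (z * z⁻¹)   ≡⟨ cong (y *_) zz⁻¹≡1 ⟩
    y * 1#          ≡⟨ *-identityʳ y ⟩
    y               ∎
    where open ≡-Reasoning

  no-zero-divisors : ∀ {x y} → ¬ x ≡ 0# → x * y ≡ 0# → y ≡ 0#
  no-zero-divisors {x} {y} x≢0 xy≡0 =
    *-cancelʳ-≢0 x≢0 (trans (*-comm y x) (trans xy≡0 (sym (zeroˡ x))))

  𝟙-≟0-scale : ∀ {α} → ¬ α ≡ 0# → ∀ x → 𝟙 (α * x ≟0) ≡ 𝟙 (x ≟0)
  𝟙-≟0-scale {α} α≢0 x =
    𝟙-cong (mk⇔ (no-zero-divisors α≢0) (λ x≡0 → trans (cong (α *_) x≡0) (zeroʳ α))) _ _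

  affine-root : ∀ {t} s → ¬ t ≡ 0# → ∃ λ r → ∀ x → (x * t + s ≡ 0#) ⇔ (x ≡ r)
  affine-root {t} s t≢0 with inverse t t≢0
  ... | t⁻¹ , tt⁻¹≡1 = r , λ x → mk⇔ (unique x) (λ { refl → root })
    where
    r : Carrier
    r = - s * t⁻¹
    root : r * t + s ≡ 0#
    root = begin
      - s * t⁻¹ * t + s     ≡⟨ cong (_+ s) (*-assoc (- s) t⁻¹ t) ⟩
      - s * (t⁻¹ * t) + s   ≡⟨ cong (λ y → - s * y + s) (trans (*-comm t⁻¹ t) tt⁻¹≡1) ⟩
      - s * 1# + s          ≡⟨ cong (_+ s) (*-identityʳ (- s)) ⟩
      - s + s               ≡⟨ -‿inverseˡ s ⟩
      0#                    ∎
      where open ≡-Reasoning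
    unique : ∀ x → x * t + s ≡ 0# → x ≡ r
    unique x xt+s≡0 = *-cancelʳ-≢0 t≢0 (∙-cancelʳ s (x * t) (r * t) (trans xt+s≡0 (sym root)))

  -- elements may list a field element more than once; counting needs each exactly once.
  distinctEnumeration : FiniteField
  distinctEnumeration = record F
    { elements = deduplicate _≟_ elements
    ; complete = λ x → ∈-deduplicate⁺ _≟_ (complete x)
    }

  𝔽 : List Carrier
  𝔽 = FiniteField.elements distinctEnumeration

  q : ℕ
  q = length 𝔽

  ∑-𝟙≟ : ∀ r → ∑[ x ∈ 𝔽 ] 𝟙 (x ≟ r) ≡ 1
  ∑-𝟙≟ r = ∑-𝟙≟-unique _≟_ (deduplicate-! _≟_ elements) (FiniteField.complete distinctEnumeration r)

  2≤q : 2 ℕ.≤ q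
  2≤q = begin
    2                                                ≡⟨ cong₂ ℕ._+_ (∑-𝟙≟ 0#) (∑-𝟙≟ 1#) ⟨
    ∑[ x ∈ 𝔽 ] 𝟙 (x ≟0) ℕ.+ ∑[ x ∈ 𝔽 ] 𝟙 (x ≟ 1#)   ≡⟨ ∑-+ 𝔽 _ _ ⟨
    ∑[ x ∈ 𝔽 ] (𝟙 (x ≟0) ℕ.+ 𝟙 (x ≟ 1#))            ≤⟨ ∑-mono-≤ 𝔽 at-most-one ⟩
    ∑[ x ∈ 𝔽 ] 1                                     ≡⟨ ∑-const 𝔽 1 ⟩
    q ℕ.* 1                                          ≡⟨ ℕ.*-identityʳ q ⟩
    q                                                ∎
    where
    open ℕ.≤-Reasoning
    at-most-one : ∀ x → 𝟙 (x ≟0) ℕ.+ 𝟙 (x ≟ 1#) ℕ.≤ 1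
    at-most-one x with x ≟ 0# | x ≟ 1#
    ... | yes refl | yes 0≡1 = ⊥-elim (0≢1 0≡1)
    ... | yes _    | no  _   = ℕ.≤-refl
    ... | no  _    | yes _   = ℕ.≤-refl
    ... | no  _    | no  _   = ℕ.z≤n

  ∑-roots-≢0 : ∀ {t} s → ¬ t ≡ 0# → ∑[ x ∈ 𝔽 ] 𝟙 (x * t + s ≟0) ≡ 1
  ∑-roots-≢0 s t≢0 with affine-root s t≢0
  ... | r , root⇔ = trans (∑-cong 𝔽 (λ {x} _ → 𝟙-cong (root⇔ x) _ _)) (∑-𝟙≟ r)

  ∑-roots-0 : ∀ s → ∑[ x ∈ 𝔽 ] 𝟙 (x * 0# + s ≟0) ≡ q ℕ.* 𝟙 (s ≟0)
  ∑-roots-0 s = trans (∑-cong 𝔽 (λ {x} _ → cong (λ y → 𝟙 (y ≟0)) (x0+s≡s x))) (∑-const 𝔽 _)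
    where
    x0+s≡s : ∀ x → x * 0# + s ≡ s
    x0+s≡s x = trans (cong (_+ s) (zeroʳ x)) (+-identityˡ s)

  ∑-affine-roots : ∀ t s →
    ∑[ μ ∈ 𝔽 ] 𝟙 (μ * t + s ≟0) ℕ.+ 𝟙 (t ≟0) ≡ 1 ℕ.+ q ℕ.* (𝟙 (t ≟0) ℕ.* 𝟙 (s ≟0))
  ∑-affine-roots t s with t ≟0
  ... | yes refl = trans (ℕ.+-comm (∑ 𝔽 _) 1)
    (cong (1 ℕ.+_) (trans (∑-roots-0 s) (cong (q ℕ.*_) (sym (ℕ.*-identityˡ _)))))
  ... | no t≢0 = trans (ℕ.+-identityʳ _) (trans (∑-roots-≢0 s t≢0) (cong suc (sym (ℕ.*-zeroʳ q))))

  gap : ℕ → ℕ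
  gap k = (q ℕ.∸ 1) ℕ.* q ℕ.^ k

  q*q^k≡q^k+gap : ∀ k → q ℕ.* q ℕ.^ k ≡ q ℕ.^ k ℕ.+ gap k
  q*q^k≡q^k+gap k = begin
    q ℕ.* q ℕ.^ k                   ≡⟨ cong (ℕ._* q ℕ.^ k) (ℕ.m+[n∸m]≡n (ℕ.<⇒≤ 2≤q)) ⟨
    (1 ℕ.+ (q ℕ.∸ 1)) ℕ.* q ℕ.^ k   ≡⟨ ℕ.*-distribʳ-+ (q ℕ.^ k) 1 (q ℕ.∸ 1) ⟩
    1 ℕ.* q ℕ.^ k ℕ.+ gap k         ≡⟨ cong (ℕ._+ gap k) (ℕ.*-identityˡ (q ℕ.^ k)) ⟩
    q ℕ.^ k ℕ.+ gap k               ∎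
    where open ≡-Reasoning

  gap≢0 : ∀ k → ¬ gap k ≡ 0
  gap≢0 k gap≡0 with ℕ.m*n≡0⇒m≡0∨n≡0 (q ℕ.∸ 1) gap≡0
  ... | inj₁ q∸1≡0 = ℕ.<⇒≱ (ℕ.m<n⇒0<n∸m 2≤q) (ℕ.≤-reflexive q∸1≡0)
  ... | inj₂ q^k≡0 = ℕ.<⇒≱ 2≤q (ℕ.≤-trans (ℕ.≤-reflexive (ℕ.m^n≡0⇒m≡0 q k q^k≡0)) ℕ.z≤n)

module VectorAlgebra (F : FiniteField) where
  open FiniteField F
  open IsCommutativeRing isCommutativeRing
    using (+-identityˡ; +-identityʳ; zeroˡ; zeroʳ; *-identityˡ; *-identityʳ; *-comm; *-assoc; distribˡ; distribʳ)
  open CommutativeRing (FieldFacts.commutativeRing F) using (+-commutativeSemigroup; *-commutativeSemigroup)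
  open import Algebra.Properties.CommutativeSemigroup +-commutativeSemigroup using (interchange; x∙yz≈yx∙z)
  open import Algebra.Properties.CommutativeSemigroup *-commutativeSemigroup using (x∙yz≈y∙xz)

  infixl 6 _⊞_
  infixr 7 _⊡_
  infix  8 _∙_
  infix  4 _≟ᵥ_

  _⊞_ : ∀ {k} → Vec Carrier k → Vec Carrier k → Vec Carrier k
  _⊞_ = _+ᵥ_ F

  _⊡_ : ∀ {k} → Carrier → Vec Carrier k → Vec Carrier k
  _⊡_ = _·ᵥ_ F

  _∙_ : ∀ {k} → Vec Carrier k → Vec Carrier k → Carrier
  _∙_ = dot F

  0ᵥ : ∀ {k} → Vec Carrier k
  0ᵥ = zeroV F

  _≟ᵥ_ : ∀ {k} (u v : Vec Carrier k) → Dec (u ≡ v)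
  _≟ᵥ_ = ≡-dec _≟_

  ⊞-identityˡ : ∀ {k} (u : Vec Carrier k) → 0ᵥ ⊞ u ≡ u
  ⊞-identityˡ = zipWith-identityˡ +-identityˡ

  ⊞-identityʳ : ∀ {k} (u : Vec Carrier k) → u ⊞ 0ᵥ ≡ u
  ⊞-identityʳ = zipWith-identityʳ +-identityʳ

  ⊞-interchange : ∀ {k} (u v w z : Vec Carrier k) → (u ⊞ v) ⊞ (w ⊞ z) ≡ (u ⊞ w) ⊞ (v ⊞ z)
  ⊞-interchange []       []       []       []       = refl
  ⊞-interchange (u ∷ us) (v ∷ vs) (w ∷ ws) (z ∷ zs) =
    cong₂ _∷_ (interchange u v w z) (⊞-interchange us vs ws zs)

  ⊡-zeroˡ : ∀ {k} (u : Vec Carrier k) → 0# ⊡ u ≡ 0ᵥ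
  ⊡-zeroˡ []       = refl
  ⊡-zeroˡ (u ∷ us) = cong₂ _∷_ (zeroˡ u) (⊡-zeroˡ us)

  ⊡-zeroʳ : ∀ {k} c → c ⊡ 0ᵥ {k} ≡ 0ᵥ
  ⊡-zeroʳ {k} c = trans (map-replicate (c *_) 0# k) (cong (Vec.replicate k) (zeroʳ c))

  ⊡-assoc : ∀ {k} c d (u : Vec Carrier k) → c ⊡ d ⊡ u ≡ (c * d) ⊡ u
  ⊡-assoc c d []       = refl
  ⊡-assoc c d (u ∷ us) = cong₂ _∷_ (sym (*-assoc c d u)) (⊡-assoc c d us)

  ⊡-distribˡ : ∀ {k} c (u v : Vec Carrier k) → c ⊡ (u ⊞ v) ≡ c ⊡ u ⊞ c ⊡ v
  ⊡-distribˡ c []       []       = refl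
  ⊡-distribˡ c (u ∷ us) (v ∷ vs) = cong₂ _∷_ (distribˡ c u v) (⊡-distribˡ c us vs)

  ⊡-distribʳ : ∀ {k} c d (u : Vec Carrier k) → (c + d) ⊡ u ≡ c ⊡ u ⊞ d ⊡ u
  ⊡-distribʳ c d []       = refl
  ⊡-distribʳ c d (u ∷ us) = cong₂ _∷_ (distribʳ u c d) (⊡-distribʳ c d us)

  ∙-zeroˡ : ∀ {k} (v : Vec Carrier k) → 0ᵥ ∙ v ≡ 0#
  ∙-zeroˡ []       = refl
  ∙-zeroˡ (v ∷ vs) = trans (cong₂ _+_ (zeroˡ v) (∙-zeroˡ vs)) (+-identityʳ 0#)

  ∙-zeroʳ : ∀ {k} (a : Vec Carrier k) → a ∙ 0ᵥ ≡ 0#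
  ∙-zeroʳ []       = refl
  ∙-zeroʳ (a ∷ as) = trans (cong₂ _+_ (zeroʳ a) (∙-zeroʳ as)) (+-identityʳ 0#)

  ∙-⊞ : ∀ {k} (a u v : Vec Carrier k) → a ∙ (u ⊞ v) ≡ a ∙ u + a ∙ v
  ∙-⊞ []       []       []       = sym (+-identityʳ 0#)
  ∙-⊞ (a ∷ as) (u ∷ us) (v ∷ vs) =
    trans (cong₂ _+_ (distribˡ a u v) (∙-⊞ as us vs)) (interchange (a * u) (a * v) (as ∙ us) (as ∙ vs))

  ∙-⊡ : ∀ {k} (a : Vec Carrier k) c v → a ∙ (c ⊡ v) ≡ c * a ∙ v
  ∙-⊡ []       c []       = sym (zeroʳ c)
  ∙-⊡ (a ∷ as) c (v ∷ vs) =
    trans (cong₂ _+_ (x∙yz≈y∙xz a c v) (∙-⊡ as c vs)) (sym (distribˡ c (a * v) (as ∙ vs)))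

  ∙-lincomb₂ : ∀ {k} (a X Q : Vec Carrier k) α β → a ∙ Q ≡ 0# →
    a ∙ lincomb F (α ∷ β ∷ []) (X ∷ Q ∷ []) ≡ α * a ∙ X
  ∙-lincomb₂ a X Q α β a∙Q≡0 = begin
    a ∙ (α ⊡ X ⊞ (β ⊡ Q ⊞ 0ᵥ))   ≡⟨ cong (λ v → a ∙ (α ⊡ X ⊞ v)) (⊞-identityʳ (β ⊡ Q)) ⟩
    a ∙ (α ⊡ X ⊞ β ⊡ Q)           ≡⟨ ∙-⊞ a (α ⊡ X) (β ⊡ Q) ⟩
    a ∙ (α ⊡ X) + a ∙ (β ⊡ Q)     ≡⟨ cong₂ _+_ (∙-⊡ a α X) (∙-⊡ a β Q) ⟩
    α * a ∙ X + β * a ∙ Q         ≡⟨ cong (λ y → α * a ∙ X + β * y) a∙Q≡0 ⟩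
    α * a ∙ X + β * 0#            ≡⟨ cong (α * a ∙ X +_) (zeroʳ β) ⟩
    α * a ∙ X + 0#                ≡⟨ +-identityʳ (α * a ∙ X) ⟩
    α * a ∙ X                     ∎
    where open ≡-Reasoning

  lincomb-zero : ∀ {k j} (bs : Vec (Vec Carrier k) j) → lincomb F 0ᵥ bs ≡ 0ᵥ
  lincomb-zero []       = refl
  lincomb-zero (b ∷ bs) = trans (cong₂ _⊞_ (⊡-zeroˡ b) (lincomb-zero bs)) (⊞-identityʳ 0ᵥ)

  lincomb-⊡ : ∀ {k j} c (cs : Vec Carrier j) (bs : Vec (Vec Carrier k) j) →
    c ⊡ lincomb F cs bs ≡ lincomb F (c ⊡ cs) bs
  lincomb-⊡ c []       []       = ⊡-zeroʳ c
  lincomb-⊡ c (d ∷ cs) (b ∷ bs) =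
    trans (⊡-distribˡ c (d ⊡ b) (lincomb F cs bs)) (cong₂ _⊞_ (⊡-assoc c d b) (lincomb-⊡ c cs bs))

  lincomb-⊞ : ∀ {k j} (cs ds : Vec Carrier j) (bs : Vec (Vec Carrier k) j) →
    lincomb F cs bs ⊞ lincomb F ds bs ≡ lincomb F (cs ⊞ ds) bs
  lincomb-⊞ []       []       []       = ⊞-identityʳ 0ᵥ
  lincomb-⊞ (c ∷ cs) (d ∷ ds) (b ∷ bs) =
    trans (⊞-interchange (c ⊡ b) (lincomb F cs bs) (d ⊡ b) (lincomb F ds bs))
          (cong₂ _⊞_ (sym (⊡-distribʳ c d b)) (lincomb-⊞ cs ds bs))

  lincomb-0∷ : ∀ {k j} {u w : Vec Carrier k} (cs : Vec Carrier j) vs →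
    lincomb F (0# ∷ cs) (u ∷ vs) ≡ lincomb F (0# ∷ cs) (w ∷ vs)
  lincomb-0∷ {u = u} {w} cs vs = cong (_⊞ lincomb F cs vs) (trans (⊡-zeroˡ u) (sym (⊡-zeroˡ w)))

  InSpan-lincomb : ∀ {k j i} {bs : Vec (Vec Carrier k) j} (cs : Vec Carrier i) {vs} →
    VecAll.All (InSpan F bs) vs → InSpan F bs (lincomb F cs vs)
  InSpan-lincomb {bs = bs} []       []                 = 0ᵥ , sym (lincomb-zero bs)
  InSpan-lincomb {bs = bs} (c ∷ cs) ((ds , v≡) ∷ vs∈) with InSpan-lincomb cs vs∈
  ... | es , w≡ = c ⊡ ds ⊞ es , (begin
    c ⊡ _ ⊞ lincomb F cs _                    ≡⟨ cong₂ (λ v w → c ⊡ v ⊞ w) v≡ w≡ ⟩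
    c ⊡ lincomb F ds bs ⊞ lincomb F es bs     ≡⟨ cong (_⊞ lincomb F es bs) (lincomb-⊡ c ds bs) ⟩
    lincomb F (c ⊡ ds) bs ⊞ lincomb F es bs   ≡⟨ lincomb-⊞ (c ⊡ ds) es bs ⟩
    lincomb F (c ⊡ ds ⊞ es) bs                ∎)
    where open ≡-Reasoning

  normalized⇒≢0 : ∀ {k} {v : Vec Carrier k} → Normalized F v → ¬ v ≡ 0ᵥ
  normalized⇒≢0 {v = x ∷ v} (inj₁ x≡1)      v≡0 = 0≢1 (trans (sym (proj₁ (∷-injective v≡0))) x≡1)
  normalized⇒≢0 {v = x ∷ v} (inj₂ (_ , nv)) v≡0 = normalized⇒≢0 nv (proj₂ (∷-injective v≡0))

  normalize : ∀ {k} (v : Vec Carrier k) → ¬ v ≡ 0ᵥ → ∃ λ l → ¬ l ≡ 0# × Normalized F (l ⊡ v)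
  normalize []      v≢0 = ⊥-elim (v≢0 refl)
  normalize (x ∷ v) v≢0 with x ≟ 0#
  ... | yes refl with normalize v (v≢0 ∘ cong (0# ∷_))
  ...   | l , l≢0 , nv = l , l≢0 , inj₂ (zeroʳ l , nv)
  normalize (x ∷ v) v≢0 | no x≢0 with inverse x x≢0
  ...   | x⁻¹ , xx⁻¹≡1 = x⁻¹ , x⁻¹≢0 , inj₁ (trans (*-comm x⁻¹ x) xx⁻¹≡1)
    where
    x⁻¹≢0 : ¬ x⁻¹ ≡ 0#
    x⁻¹≢0 x⁻¹≡0 = 0≢1 (trans (sym (zeroʳ x)) (trans (cong (x *_) (sym x⁻¹≡0)) xx⁻¹≡1))

  ⊡-⊞-cancel : ∀ {k μ} {Y Z : Vec Carrier k} → μ + 1# ≡ 0# → μ ⊡ Y ⊞ Z ≡ 0ᵥ → Z ≡ Y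
  ⊡-⊞-cancel {Y = []}    {[]}    μ+1≡0 eq = refl
  ⊡-⊞-cancel {μ = μ} {y ∷ Y} {z ∷ Z} μ+1≡0 eq =
    cong₂ _∷_ z≡y (⊡-⊞-cancel μ+1≡0 (proj₂ (∷-injective eq)))
    where
    open ≡-Reasoning
    z≡y : z ≡ y
    z≡y = begin
      z                  ≡⟨ +-identityʳ z ⟨
      z + 0#             ≡⟨ cong (z +_) (trans (cong (_* y) μ+1≡0) (zeroˡ y)) ⟨
      z + (μ + 1#) * y   ≡⟨ cong (z +_) (trans (distribʳ y μ 1#) (cong (μ * y +_) (*-identityˡ y))) ⟩
      z + (μ * y + y)    ≡⟨ x∙yz≈yx∙z z (μ * y) y ⟩
      μ * y + z + y      ≡⟨ cong (_+ y) (proj₁ (∷-injective eq)) ⟩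
      0# + y             ≡⟨ +-identityˡ y ⟩
      y                  ∎

  normalized-independent : ∀ {k} {Y Z : Vec Carrier k} → Normalized F Y → Normalized F Z → ¬ Z ≡ Y →
    ∀ μ → ¬ μ ⊡ Y ⊞ Z ≡ 0ᵥ
  normalized-independent {Y = _ ∷ Y} {_ ∷ Z} (inj₁ refl) (inj₁ refl) Z≢Y μ eq =
    Z≢Y (cong (1# ∷_) (⊡-⊞-cancel μ+1≡0 (proj₂ (∷-injective eq))))
    where
    μ+1≡0 : μ + 1# ≡ 0#
    μ+1≡0 = trans (cong (_+ 1#) (sym (*-identityʳ μ))) (proj₁ (∷-injective eq))
  normalized-independent {Y = _ ∷ Y} {_ ∷ Z} (inj₁ refl) (inj₂ (refl , nZ)) Z≢Y μ eq =
    normalized⇒≢0 nZ (begin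
      Z              ≡⟨ ⊞-identityˡ Z ⟨
      0ᵥ ⊞ Z         ≡⟨ cong (_⊞ Z) (⊡-zeroˡ Y) ⟨
      0# ⊡ Y ⊞ Z     ≡⟨ cong (λ c → c ⊡ Y ⊞ Z) μ≡0 ⟨
      μ ⊡ Y ⊞ Z      ≡⟨ proj₂ (∷-injective eq) ⟩
      0ᵥ             ∎)
    where
    open ≡-Reasoning
    μ≡0 : μ ≡ 0#
    μ≡0 = trans (sym (trans (+-identityʳ (μ * 1#)) (*-identityʳ μ))) (proj₁ (∷-injective eq))
  normalized-independent {Y = _ ∷ Y} {_ ∷ Z} (inj₂ (refl , _)) (inj₁ refl) Z≢Y μ eq =
    0≢1 (trans (sym (proj₁ (∷-injective eq))) (trans (cong (_+ 1#) (zeroʳ μ)) (+-identityˡ 1#)))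
  normalized-independent {Y = _ ∷ Y} {_ ∷ Z} (inj₂ (refl , nY)) (inj₂ (refl , nZ)) Z≢Y μ eq =
    normalized-independent nY nZ (Z≢Y ∘ cong (0# ∷_)) μ (proj₂ (∷-injective eq))

module Annihilators (F : FiniteField) where
  open FiniteField F using (Carrier; _+_; _*_; 0#; _≟_)
  open FieldFacts F
  open VectorAlgebra F
  open ≡-Reasoning

  vectors : (k : ℕ) → List (Vec Carrier k)
  vectors = allVecs distinctEnumeration

  ∈-vectors : ∀ {k} (v : Vec Carrier k) → v ∈ vectors k
  ∈-vectors = ∈-allVecs distinctEnumeration _

  ∑-vectors : ∀ k (g : Vec Carrier (suc k) → ℕ) →
    ∑ (vectors (suc k)) g ≡ ∑[ x ∈ 𝔽 ] ∑[ w ∈ vectors k ] g (x ∷ w)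
  ∑-vectors = ∑-allVecs distinctEnumeration

  ∑-vectors-1 : ∀ k → ∑[ _ ∈ vectors k ] 1 ≡ q ℕ.^ k
  ∑-vectors-1 zero    = refl
  ∑-vectors-1 (suc k) = trans (∑-vectors k _) (trans (∑-cong 𝔽 (λ _ → ∑-vectors-1 k)) (∑-const 𝔽 _))

  #annihilators : ∀ {k} → Vec Carrier k → ℕ
  #annihilators {k} Z = ∑[ a ∈ vectors k ] 𝟙 (a ∙ Z ≟0)

  #commonAnnihilators : ∀ {k} → Vec Carrier k → Vec Carrier k → ℕ
  #commonAnnihilators {k} Y Z = ∑[ a ∈ vectors k ] (𝟙 (a ∙ Y ≟0) ℕ.* 𝟙 (a ∙ Z ≟0))

  #annihilators-≢0 : ∀ {k} (Z : Vec Carrier (suc k)) → ¬ Z ≡ 0ᵥ → #annihilators Z ≡ q ℕ.^ k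
  #annihilators-≢0 {k} (z ∷ Z) Z≢0 with z ≟ 0#
  ... | no z≢0 = begin
    #annihilators (z ∷ Z)                        ≡⟨ ∑-vectors k _ ⟩
    ∑[ x ∈ 𝔽 ] ∑[ w ∈ A ] 𝟙 (x * z + w ∙ Z ≟0)   ≡⟨ ∑-swap 𝔽 A _ ⟩
    ∑[ w ∈ A ] ∑[ x ∈ 𝔽 ] 𝟙 (x * z + w ∙ Z ≟0)   ≡⟨ ∑-cong A (λ {w} _ → ∑-roots-≢0 (w ∙ Z) z≢0) ⟩
    ∑[ w ∈ A ] 1                                 ≡⟨ ∑-vectors-1 k ⟩
    q ℕ.^ k                                      ∎
    where
    A = vectors k
  #annihilators-≢0 {zero}  (z ∷ []) Z≢0 | yes refl = ⊥-elim (Z≢0 refl)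
  #annihilators-≢0 {suc k} (z ∷ Z)  Z≢0 | yes refl = begin
    #annihilators (0# ∷ Z)                        ≡⟨ ∑-vectors (suc k) _ ⟩
    ∑[ x ∈ 𝔽 ] ∑[ w ∈ A ] 𝟙 (x * 0# + w ∙ Z ≟0)   ≡⟨ ∑-swap 𝔽 A _ ⟩
    ∑[ w ∈ A ] ∑[ x ∈ 𝔽 ] 𝟙 (x * 0# + w ∙ Z ≟0)   ≡⟨ ∑-cong A (λ {w} _ → ∑-roots-0 (w ∙ Z)) ⟩
    ∑[ w ∈ A ] (q ℕ.* 𝟙 (w ∙ Z ≟0))               ≡⟨ ∑-*ˡ A q _ ⟩
    q ℕ.* #annihilators Z                         ≡⟨ cong (q ℕ.*_) (#annihilators-≢0 Z (Z≢0 ∘ cong (0# ∷_))) ⟩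
    q ℕ.* q ℕ.^ k                                 ∎
    where
    A = vectors (suc k)

  -- Summing #annihilators over the q points μY + Z counts every a with a·Y ≢ 0 once
  -- and every common annihilator of Y and Z q times.
  q*#commonAnnihilators-independent : ∀ {k} (Y Z : Vec Carrier (suc k)) → ¬ Y ≡ 0ᵥ →
    (∀ μ → ¬ μ ⊡ Y ⊞ Z ≡ 0ᵥ) → q ℕ.* #commonAnnihilators Y Z ≡ q ℕ.^ k
  q*#commonAnnihilators-independent {k} Y Z Y≢0 independent =
    ℕ.+-cancelˡ-≡ (q ℕ.* q ℕ.^ k) _ _ (begin
      q ℕ.* q ℕ.^ k ℕ.+ q ℕ.* #commonAnnihilators Y Z
        ≡⟨ cong₂ ℕ._+_ (∑-vectors-1 (suc k)) (∑-*ˡ A q _) ⟨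
      ∑[ _ ∈ A ] 1 ℕ.+ ∑[ a ∈ A ] (q ℕ.* (𝟙 (a ∙ Y ≟0) ℕ.* 𝟙 (a ∙ Z ≟0)))
        ≡⟨ ∑-+ A _ _ ⟨
      ∑[ a ∈ A ] (1 ℕ.+ q ℕ.* (𝟙 (a ∙ Y ≟0) ℕ.* 𝟙 (a ∙ Z ≟0)))
        ≡⟨ ∑-cong A (λ {a} _ → trans (cong (ℕ._+ _) (∑-cong 𝔽 (λ {μ} _ → ∙-line a μ)))
                                     (∑-affine-roots (a ∙ Y) (a ∙ Z))) ⟨
      ∑[ a ∈ A ] (∑[ μ ∈ 𝔽 ] 𝟙 (a ∙ (μ ⊡ Y ⊞ Z) ≟0) ℕ.+ 𝟙 (a ∙ Y ≟0))
        ≡⟨ ∑-+ A _ _ ⟩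
      ∑[ a ∈ A ] ∑[ μ ∈ 𝔽 ] 𝟙 (a ∙ (μ ⊡ Y ⊞ Z) ≟0) ℕ.+ #annihilators Y
        ≡⟨ cong₂ ℕ._+_ (∑-swap A 𝔽 _) (#annihilators-≢0 Y Y≢0) ⟩
      ∑[ μ ∈ 𝔽 ] #annihilators (μ ⊡ Y ⊞ Z) ℕ.+ q ℕ.^ k
        ≡⟨ cong (ℕ._+ q ℕ.^ k) (trans (∑-cong 𝔽 (λ {μ} _ → #annihilators-≢0 _ (independent μ)))
                                      (∑-const 𝔽 _)) ⟩
      q ℕ.* q ℕ.^ k ℕ.+ q ℕ.^ k ∎)
    where
    A = vectors (suc k)
    ∙-line : ∀ a μ → 𝟙 (a ∙ (μ ⊡ Y ⊞ Z) ≟0) ≡ 𝟙 (μ * a ∙ Y + a ∙ Z ≟0)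
    ∙-line a μ = cong (λ v → 𝟙 (v ≟0)) (trans (∙-⊞ a (μ ⊡ Y) Z) (cong (_+ a ∙ Z) (∙-⊡ a μ Y)))

  q*#commonAnnihilators-points : ∀ {k} {Y Z : Vec Carrier (suc k)} → Normalized F Y → Normalized F Z →
    q ℕ.* #commonAnnihilators Y Z ≡ q ℕ.^ k ℕ.+ 𝟙 (Z ≟ᵥ Y) ℕ.* gap k
  q*#commonAnnihilators-points {k} {Y} {Z} nY nZ with Z ≟ᵥ Y
  ... | yes refl = begin
    q ℕ.* #commonAnnihilators Y Y   ≡⟨ cong (q ℕ.*_) (∑-cong (vectors (suc k)) (λ {a} _ → 𝟙-idem (a ∙ Y ≟0))) ⟩
    q ℕ.* #annihilators Y           ≡⟨ cong (q ℕ.*_) (#annihilators-≢0 Y (normalized⇒≢0 nY)) ⟩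
    q ℕ.* q ℕ.^ k                   ≡⟨ q*q^k≡q^k+gap k ⟩
    q ℕ.^ k ℕ.+ gap k               ≡⟨ cong (q ℕ.^ k ℕ.+_) (ℕ.*-identityˡ (gap k)) ⟨
    q ℕ.^ k ℕ.+ 1 ℕ.* gap k         ∎
  ... | no Z≢Y = trans
    (q*#commonAnnihilators-independent Y Z (normalized⇒≢0 nY) (normalized-independent nY nZ Z≢Y))
    (sym (ℕ.+-identityʳ (q ℕ.^ k)))

module Cone {F : FiniteField} {n m : ℕ} (V : Subspace F n m) {K : Pred (Vector F n) 0ℓ} (K? : Decidable K)
  (equicardinal : ∀ H H′ → ¬ ContainsSub F H V → ¬ ContainsSub F H′ V → countOn F K? H ≡ countOn F K? H′)
  where
  open import Data.Nat using (_+_; _*_; _^_; _≤_)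
  open import Data.Nat.Properties
    using (+-cancelˡ-≡; *-zeroʳ; *-identityˡ; *-distribˡ-+; *-assoc; m*n≡0⇒m≡0∨n≡0; <⇒≱; ≤-trans; ≤-reflexive)
  open import Algebra.Properties.CommutativeSemigroup ℕ.*-commutativeSemigroup using (x∙yz≈y∙xz)
  open FiniteField F using (0#) renaming (_*_ to _*ᶠ_)
  open FieldFacts F
  open VectorAlgebra F
  open Annihilators F
  open ≡-Reasoning

  B : Vec (Vector F n) (suc m)
  B = Subspace.basis V

  points : List (Vector F n)
  points = allPoints F n

  ∈-points⁺ : ∀ {P} → Normalized F P → P ∈ points
  ∈-points⁺ {P} nP = ∈-filter⁺ (normalized? F) (∈-allVecs F (suc n) P) nP

  ∈-points⁻ : ∀ {P} → P ∈ points → Normalized F P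
  ∈-points⁻ P∈ = proj₂ (∈-filter⁻ (normalized? F) {xs = allVecs F (suc n)} P∈)

  -- The hyperplane with coordinate vector a contains V (decidably: test every combination of B).
  Annihilates : Pred (Vector F n) 0ℓ
  Annihilates a = All (λ cs → a ∙ lincomb F cs B ≡ 0#) (vectors (suc m))

  annihilates? : Decidable Annihilates
  annihilates? a = all? (λ cs → a ∙ lincomb F cs B ≟0) (vectors (suc m))

  annihilates-span : ∀ {a Q} → Annihilates a → InSpan F B Q → a ∙ Q ≡ 0#
  annihilates-span ann (cs , refl) = All.lookup ann (∈-vectors cs)

  ¬annihilates-witness : ∀ {a} → ¬ Annihilates a → ∃ λ cs → ¬ a ∙ lincomb F cs B ≡ 0#
  ¬annihilates-witness {a} ¬ann = satisfied (¬All⇒Any¬ (λ cs → a ∙ lincomb F cs B ≟0) (vectors (suc m)) ¬ann)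

  ¬annihilates⇒≢0 : ∀ {a} → ¬ Annihilates a → ¬ a ≡ 0ᵥ
  ¬annihilates⇒≢0 {a} ¬ann a≡0 with ¬annihilates-witness {a} ¬ann
  ... | cs , a∙v≢0 = a∙v≢0 (trans (cong (_∙ lincomb F cs B) a≡0) (∙-zeroˡ (lincomb F cs B)))

  ¬annihilates⇒¬ContainsSub : ∀ {a} (¬ann : ¬ Annihilates a) → ¬ ContainsSub F (a , ¬annihilates⇒≢0 {a} ¬ann) V
  ¬annihilates⇒¬ContainsSub {a} ¬ann V⊆H with ¬annihilates-witness {a} ¬ann
  ... | cs , a∙v≢0 with normalize (lincomb F cs B) (λ v≡0 → a∙v≢0 (trans (cong (a ∙_) v≡0) (∙-zeroʳ a)))
  ...   | l , l≢0 , nlv with V⊆H _ (nlv , l ⊡ cs , lincomb-⊡ l cs B)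
  ...     | _ , a∙lv≡0 = a∙v≢0 (no-zero-divisors l≢0 (trans (sym (∙-⊡ a l (lincomb F cs B))) a∙lv≡0))

  #K-on : Vector F n → ℕ
  #K-on a = length (filter (λ P → K? P ×-dec (normalized? F P ×-dec (a ∙ P ≟0))) points)

  #K-on-constant : ∃ λ c → ∀ a → ¬ Annihilates a → #K-on a ≡ c
  #K-on-constant with any? (¬? ∘ annihilates?) (vectors (suc n))
  ... | yes some with satisfied some
  ...   | a₀ , ¬ann₀ = #K-on a₀ , λ a ¬ann →
    equicardinal (a , ¬annihilates⇒≢0 {a} ¬ann) (a₀ , ¬annihilates⇒≢0 {a₀} ¬ann₀)
      (¬annihilates⇒¬ContainsSub {a} ¬ann) (¬annihilates⇒¬ContainsSub {a₀} ¬ann₀)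
  #K-on-constant | no none = 0 , λ a ¬ann → ⊥-elim (none (lose (∈-vectors a) ¬ann))

  #K-on-∑ : ∀ a → #K-on a ≡ ∑[ P ∈ points ] (𝟙 (K? P) * 𝟙 (a ∙ P ≟0))
  #K-on-∑ a = trans (length-filter≡∑𝟙 _ points) (∑-cong points λ {P} P∈ → begin
    𝟙 (K? P ×-dec (normalized? F P ×-dec (a ∙ P ≟0)))
      ≡⟨ 𝟙-× (K? P) _ ⟩
    𝟙 (K? P) * 𝟙 (normalized? F P ×-dec (a ∙ P ≟0))
      ≡⟨ cong (𝟙 (K? P) *_) (𝟙-× (normalized? F P) _) ⟩
    𝟙 (K? P) * (𝟙 (normalized? F P) * 𝟙 (a ∙ P ≟0))
      ≡⟨ cong (λ i → 𝟙 (K? P) * (i * 𝟙 (a ∙ P ≟0))) (normalized≡1 P∈) ⟩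
    𝟙 (K? P) * (1 * 𝟙 (a ∙ P ≟0))
      ≡⟨ cong (𝟙 (K? P) *_) (*-identityˡ _) ⟩
    𝟙 (K? P) * 𝟙 (a ∙ P ≟0) ∎)
    where
    normalized≡1 : ∀ {P} → P ∈ points → 𝟙 (normalized? F P) ≡ 1
    normalized≡1 {P} P∈ = 𝟙-yes (∈-points⁻ P∈) (normalized? F P)

  incidences : Vector F n → ℕ
  incidences Y = ∑[ a ∈ vectors (suc n) ] (𝟙 (a ∙ Y ≟0) * #K-on a)

  incidences-cong : ∀ {X P} → Normalized F X → Normalized F P →
    (∀ a → Annihilates a → 𝟙 (a ∙ X ≟0) ≡ 𝟙 (a ∙ P ≟0)) → incidences X ≡ incidences P
  incidences-cong {X} {P} nX nP agree with #K-on-constant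
  ... | c , constant = ∑-weighted-cong (vectors (suc n)) c through-V-or-constant
    (trans (#annihilators-≢0 X (normalized⇒≢0 nX)) (sym (#annihilators-≢0 P (normalized⇒≢0 nP))))
    where
    through-V-or-constant : ∀ a → 𝟙 (a ∙ X ≟0) ≡ 𝟙 (a ∙ P ≟0) ⊎ #K-on a ≡ c
    through-V-or-constant a with annihilates? a
    ... | yes ann = inj₁ (agree a ann)
    ... | no ¬ann = inj₂ (constant a ¬ann)

  incidences-on-lines : ∀ {X P Q α β} → Normalized F X → Normalized F P → InSpan F B Q → ¬ α ≡ 0# →
    P ≡ lincomb F (α ∷ β ∷ []) (X ∷ Q ∷ []) → incidences X ≡ incidences P
  incidences-on-lines {X} {P} {Q} {α} {β} nX nP Q∈V α≢0 refl = incidences-cong nX nP λ a ann → begin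
    𝟙 (a ∙ X ≟0)
      ≡⟨ 𝟙-≟0-scale α≢0 (a ∙ X) ⟨
    𝟙 (α *ᶠ a ∙ X ≟0)
      ≡⟨ cong (λ y → 𝟙 (y ≟0)) (∙-lincomb₂ a X Q α β (annihilates-span {a} ann Q∈V)) ⟨
    𝟙 (a ∙ lincomb F (α ∷ β ∷ []) (X ∷ Q ∷ []) ≟0) ∎

  incidences-∑ : ∀ Y → incidences Y ≡ ∑[ P ∈ points ] (𝟙 (K? P) * #commonAnnihilators Y P)
  incidences-∑ Y = begin
    ∑[ a ∈ A ] (𝟙 (a ∙ Y ≟0) * #K-on a)
      ≡⟨ ∑-cong A (λ {a} _ → cong (𝟙 (a ∙ Y ≟0) *_) (#K-on-∑ a)) ⟩
    ∑[ a ∈ A ] (𝟙 (a ∙ Y ≟0) * ∑[ P ∈ points ] (𝟙 (K? P) * 𝟙 (a ∙ P ≟0)))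
      ≡⟨ ∑-cong A (λ {a} _ → ∑-*ˡ points (𝟙 (a ∙ Y ≟0)) (λ P → 𝟙 (K? P) * 𝟙 (a ∙ P ≟0))) ⟨
    ∑[ a ∈ A ] ∑[ P ∈ points ] (𝟙 (a ∙ Y ≟0) * (𝟙 (K? P) * 𝟙 (a ∙ P ≟0)))
      ≡⟨ ∑-swap A points _ ⟩
    ∑[ P ∈ points ] ∑[ a ∈ A ] (𝟙 (a ∙ Y ≟0) * (𝟙 (K? P) * 𝟙 (a ∙ P ≟0)))
      ≡⟨ ∑-cong points (λ {P} _ → trans (∑-cong A (λ {a} _ → x∙yz≈y∙xz (𝟙 (a ∙ Y ≟0)) (𝟙 (K? P)) _))
                                        (∑-*ˡ A (𝟙 (K? P)) (λ a → 𝟙 (a ∙ Y ≟0) * 𝟙 (a ∙ P ≟0)))) ⟩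
    ∑[ P ∈ points ] (𝟙 (K? P) * #commonAnnihilators Y P) ∎
    where
    A = vectors (suc n)

  -- points may list a point more than once (elements may repeat), hence a multiplicity.
  multiplicity : Vector F n → ℕ
  multiplicity Y = ∑[ P ∈ points ] (𝟙 (K? P) * 𝟙 (P ≟ᵥ Y))

  q*incidences : ∀ {Y} → Normalized F Y →
    q * incidences Y ≡ ∑[ P ∈ points ] 𝟙 (K? P) * q ^ n + multiplicity Y * gap n
  q*incidences {Y} nY = begin
    q * incidences Y
      ≡⟨ cong (q *_) (incidences-∑ Y) ⟩
    q * ∑[ P ∈ points ] (𝟙 (K? P) * #commonAnnihilators Y P)
      ≡⟨ ∑-*ˡ points q _ ⟨
    ∑[ P ∈ points ] (q * (𝟙 (K? P) * #commonAnnihilators Y P))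
      ≡⟨ ∑-cong points (λ {P} P∈ → trans (x∙yz≈y∙xz q (𝟙 (K? P)) (#commonAnnihilators Y P))
                                          (cong (𝟙 (K? P) *_) (q*#commonAnnihilators-points nY (∈-points⁻ P∈)))) ⟩
    ∑[ P ∈ points ] (𝟙 (K? P) * (q ^ n + 𝟙 (P ≟ᵥ Y) * gap n))
      ≡⟨ ∑-cong points (λ {P} _ → trans (*-distribˡ-+ (𝟙 (K? P)) _ _)
                                        (cong (𝟙 (K? P) * q ^ n +_) (sym (*-assoc (𝟙 (K? P)) _ _)))) ⟩
    ∑[ P ∈ points ] (𝟙 (K? P) * q ^ n + 𝟙 (K? P) * 𝟙 (P ≟ᵥ Y) * gap n)
      ≡⟨ trans (∑-+ points _ _) (cong₂ _+_ (∑-*ʳ points _ _) (∑-*ʳ points _ _)) ⟩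
    ∑[ P ∈ points ] 𝟙 (K? P) * q ^ n + multiplicity Y * gap n ∎

  multiplicity-∈ : ∀ {Y} → Normalized F Y → K Y → 1 ≤ multiplicity Y
  multiplicity-∈ {Y} nY KY = ≤-trans (≤-reflexive (sym term≡1)) (term≤∑ _ (∈-points⁺ nY))
    where
    term≡1 : 𝟙 (K? Y) * 𝟙 (Y ≟ᵥ Y) ≡ 1
    term≡1 = cong₂ _*_ (𝟙-yes KY (K? Y)) (𝟙-yes refl (Y ≟ᵥ Y))

  multiplicity-∉ : ∀ {Y} → ¬ K Y → multiplicity Y ≡ 0
  multiplicity-∉ {Y} ¬KY =
    trans (∑-cong points (λ {P} _ → term≡0 P)) (trans (∑-const points 0) (*-zeroʳ (length points)))
    where
    term≡0 : ∀ P → 𝟙 (K? P) * 𝟙 (P ≟ᵥ Y) ≡ 0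
    term≡0 P with P ≟ᵥ Y
    ... | yes refl = cong (_* 1) (𝟙-no ¬KY (K? P))
    ... | no _     = *-zeroʳ (𝟙 (K? P))

  K-closed-on-lines : ∀ {X P Q α β} → Normalized F X → Normalized F P → K X → InSpan F B Q → ¬ α ≡ 0# →
    P ≡ lincomb F (α ∷ β ∷ []) (X ∷ Q ∷ []) → K P
  K-closed-on-lines {X} {P} nX nP KX Q∈V α≢0 P≡ with K? P
  ... | yes KP = KP
  ... | no ¬KP = ⊥-elim (multiplicity*gap≢0 (begin
    multiplicity X * gap n   ≡⟨ +-cancelˡ-≡ _ _ _ same-q*incidences ⟩
    multiplicity P * gap n   ≡⟨ cong (_* gap n) (multiplicity-∉ ¬KP) ⟩
    0                        ∎))
    where
    same-q*incidences : _ + multiplicity X * gap n ≡ _ + multiplicity P * gap n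
    same-q*incidences = trans (sym (q*incidences nX))
      (trans (cong (q *_) (incidences-on-lines nX nP Q∈V α≢0 P≡)) (q*incidences nP))
    multiplicity*gap≢0 : ¬ multiplicity X * gap n ≡ 0
    multiplicity*gap≢0 eq with m*n≡0⇒m≡0∨n≡0 (multiplicity X) eq
    ... | inj₁ mult≡0 = <⇒≱ (multiplicity-∈ nX KX) (≤-reflexive mult≡0)
    ... | inj₂ gap≡0  = gap≢0 n gap≡0

mainTheorem7 : (F : FiniteField) (n m : ℕ) (V : Subspace F n m)
    (K : Pred (Vector F n) _) (K? : Decidable K) →
    (∀ P → K P → IsPoint F n P) →
    (∀ H H′ → ¬ ContainsSub F H V → ¬ ContainsSub F H′ V →
      countOn F K? H ≡ countOn F K? H′) →
    IsCone F V (λ P → K P ⊎ InSub F V P)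
mainTheorem7 F n m V K K? _ equicardinal = (λ _ → inj₂) , lines-through-V
  where
  open FiniteField F using (_≟_; 0#)
  open VectorAlgebra F using (InSpan-lincomb; lincomb-0∷)
  open Cone V K? equicardinal using (K-closed-on-lines)

  lines-through-V : ∀ X Q P → IsPoint F n X → K X ⊎ InSub F V X → InSub F V Q → ¬ X ≡ Q →
    OnLine F X Q P → K P ⊎ InSub F V P
  lines-through-V X Q _ _ (inj₂ (_ , X∈V)) (_ , Q∈V) _ (nP , α ∷ β ∷ [] , refl) =
    inj₂ (nP , InSpan-lincomb (α ∷ β ∷ []) (X∈V ∷ Q∈V ∷ []))
  lines-through-V X Q _ nX (inj₁ KX) (_ , Q∈V) _ (nP , α ∷ β ∷ [] , P≡) with α ≟ 0#
  ... | no α≢0   = inj₁ (K-closed-on-lines nX nP KX Q∈V α≢0 P≡)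
  ... | yes refl = inj₂ (nP , subst (InSpan F (Subspace.basis V))
    (sym (trans P≡ (lincomb-0∷ (β ∷ []) (Q ∷ [])))) (InSpan-lincomb (0# ∷ β ∷ []) (Q∈V ∷ Q∈V ∷ [])))
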